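{- For any pointed finite simple graphs $(G,v)$ and $(H,w)$, $X_{G\vee H,v}=X_{G,v}X_{H,w}$, where $G\vee H$ is the wedge sum with distinguished vertex $v=w$.
   Context: A pointed graph is a pair $(G,v)$ with $v\in V(G)$. For $S\subseteq E(G)$, $G_S$ is the graph with vertex set $V(G)$ and edge set $S$. For a graph $K$ and vertex $v$, $\mathrm{type}_v^-(K)$ is the partition whose parts are the sizes of the connected components of $K$ not containing $v$, and $\mathrm{type}_v^+(K)$ is the number of vertices of the component containing $v$. The pointed chromatic symmetric function is $X_{G,v}=\sum_{S\subseteq E(G)}(-1)^{|S|}p_{\mathrm{type}_v^-(G_S)}t^{\mathrm{type}_v^+(G_S)-1}\in\Lambda[t]$, where $\Lambda$ is the ring of symmetric functions and $p_\lambda$ are power sums. The wedge sum $(G,v)\vee(H,w)$ is the pointed graph obtained from the disjoint union of $G$ and $H$ by identifying $v$ and $w$, with this identified vertex as distinguished vertex. -}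

module Defs where

open import Data.Bool using (Bool; true; false; _∧_; _∨_; not; if_then_else_)
open import Data.Nat as ℕ using (ℕ; zero; suc; _∸_)
open import Data.Nat.Properties using (≤-decTotalOrder)
open import Data.Integer as ℤ using (ℤ)
open import Data.Fin using (Fin; zero; suc; _<?_; _≟_; splitAt; punchIn)
open import Data.List using (List; []; _∷_; _++_; map; concatMap; filter; foldr; length; allFin)
open import Data.Bool.ListAction using (all; any)
open import Data.List.Properties using (≡-dec)
open import Data.Product using (_×_; _,_; Σ)
open import Data.Sum using (_⊎_; inj₁; inj₂)
open import Relation.Nullary.Decidable using (isYes; _×-dec_)
open import Relation.Binary.PropositionalEquality using (_≡_; refl; sym; cong)
import Data.List.Sort.InsertionSort

record SimpleGraph (n : ℕ) : Set where
  field
    adj    : Fin n → Fin n → Bool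
    symm   : ∀ i j → adj i j ≡ adj j i
    irrefl : ∀ i → adj i i ≡ false
open SimpleGraph public

-- Edge set E(G): each edge {i,j} listed once, as the pair (i , j) with i < j.
edges : ∀ {n} → SimpleGraph n → List (Fin n × Fin n)
edges {n} G =
  filter (λ e → Data.Bool._≟_ (isYes (Data.Product.proj₁ e <? Data.Product.proj₂ e)
                                ∧ adj G (Data.Product.proj₁ e) (Data.Product.proj₂ e)) true)
         (concatMap (λ i → map (λ j → (i , j)) (allFin n)) (allFin n))

eqF : ∀ {n} → Fin n → Fin n → Bool
eqF i j = isYes (i ≟ j)

reach : ∀ {n} → List (Fin n × Fin n) → ℕ → Fin n → Fin n → Bool
reach S zero    u x = eqF u x
reach S (suc k) u x = reach S k u x ∨
  any (λ e → (reach S k u (Data.Product.proj₁ e) ∧ eqF (Data.Product.proj₂ e) x)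
           ∨ (reach S k u (Data.Product.proj₂ e) ∧ eqF (Data.Product.proj₁ e) x)) S

-- same component (walks of length ≤ n suffice on n vertices)
conn : ∀ {n} → List (Fin n × Fin n) → Fin n → Fin n → Bool
conn {n} S u x = reach S n u x

count : ∀ {n} → (Fin n → Bool) → ℕ
count {n} P = length (filter (λ x → Data.Bool._≟_ (P x) true) (allFin n))

compSize : ∀ {n} → List (Fin n × Fin n) → Fin n → ℕ
compSize S u = count (conn S u)

-- u is the least vertex of its component (one representative per component)
isRep : ∀ {n} → List (Fin n × Fin n) → Fin n → Bool
isRep {n} S u = all (λ x → not (isYes (x <? u) ∧ conn S u x)) (allFin n)

-- type⁻_v(G_S): sizes of the components not containing v (as a list; a
-- partition is this list up to reordering)
typeMinus : ∀ {n} → List (Fin n × Fin n) → Fin n → List ℕ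
typeMinus {n} S v =
  map (compSize S)
      (filter (λ u → Data.Bool._≟_ (isRep S u ∧ not (conn S v u)) true) (allFin n))

typePlus : ∀ {n} → List (Fin n × Fin n) → Fin n → ℕ
typePlus S v = compSize S v

-- Elements of Λ[t] with integer coefficients in the basis p_λ t^k,
-- given as formal sums of terms  c · p_λ · t^k  (λ a list of parts).

Term : Set
Term = List ℕ × ℕ × ℤ

Poly : Set
Poly = List Term

open Data.List.Sort.InsertionSort ≤-decTotalOrder using (sort)

coeff : List ℕ → ℕ → Poly → ℤ
coeff λ′ k p = foldr ℤ._+_ ℤ.0ℤ (map (λ { (a , i , c) → if isYes ((≡-dec ℕ._≟_ (sort a) (sort λ′)) ×-dec (i ℕ.≟ k)) then c else ℤ.0ℤ }) p)

-- equality in Λ[t]: the p_λ t^k (λ a partition, k ∈ ℕ) form a basis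
infix 4 _≈P_
_≈P_ : Poly → Poly → Set
p ≈P q = ∀ λ′ k → coeff λ′ k p ≡ coeff λ′ k q

-- product: p_λ p_μ = p_{λ ∪ μ}, t^i t^j = t^{i+j}
infixl 7 _*P_
_*P_ : Poly → Poly → Poly
p *P q = concatMap (λ { (a , i , c) → map (λ { (b , j , d) → (a ++ b , i ℕ.+ j , c ℤ.* d) }) q }) p

subsets : ∀ {A : Set} → List A → List (List A)
subsets []       = [] ∷ []
subsets (x ∷ xs) = subsets xs ++ map (x ∷_) (subsets xs)

sign : ℕ → ℤ
sign zero    = ℤ.1ℤ
sign (suc k) = ℤ.- sign k

X : ∀ {n} → SimpleGraph n → Fin n → Poly
X G v = map (λ S → (typeMinus S v , typePlus S v ∸ 1 , sign (length S))) (subsets (edges G))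

-- Vertex set Fin (suc m + k):
--   the first suc m vertices are those of G (inj₁ i ↦ i),
--   the remaining k vertices are those of H other than w (inj₂ j ↦ punchIn w j),
--   and w is identified with v.

module _ {m k : ℕ} (G : SimpleGraph (suc m)) (v : Fin (suc m))
                  (H : SimpleGraph (suc k)) (w : Fin (suc k)) where

  wadjC : Fin (suc m) ⊎ Fin k → Fin (suc m) ⊎ Fin k → Bool
  wadjC (inj₁ i) (inj₁ i′) = adj G i i′
  wadjC (inj₂ j) (inj₂ j′) = adj H (punchIn w j) (punchIn w j′)
  wadjC (inj₁ i) (inj₂ j)  = if eqF i v then adj H w (punchIn w j) else false
  wadjC (inj₂ j) (inj₁ i)  = if eqF i v then adj H (punchIn w j) w else false

  wadjC-sym : ∀ c d → wadjC c d ≡ wadjC d c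
  wadjC-sym (inj₁ i) (inj₁ i′) = symm G i i′
  wadjC-sym (inj₂ j) (inj₂ j′) = symm H _ _
  wadjC-sym (inj₁ i) (inj₂ j) with eqF i v
  ... | true  = symm H _ _
  ... | false = refl
  wadjC-sym (inj₂ j) (inj₁ i) with eqF i v
  ... | true  = symm H _ _
  ... | false = refl

  wadjC-irr : ∀ c → wadjC c c ≡ false
  wadjC-irr (inj₁ i) = irrefl G i
  wadjC-irr (inj₂ j) = irrefl H _

  wedge : SimpleGraph (suc m ℕ.+ k)
  wedge = record
    { adj    = λ x y → wadjC (splitAt (suc m) x) (splitAt (suc m) y)
    ; symm   = λ x y → wadjC-sym (splitAt (suc m) x) (splitAt (suc m) y)
    ; irrefl = λ x → wadjC-irr (splitAt (suc m) x)
    }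

  wedgePt : Fin (suc m ℕ.+ k)
  wedgePt = v Data.Fin.↑ˡ k

module Submission where

-- Every spanning subgraph of G ∨ H is (G ∨ H)_U with U = S ⊔ S′ for S ⊆ E(G) and S′ ⊆ E(H), so
-- X_{G∨H,v} is a double sum over pairs (S , S′) and it suffices that every summand factors.
-- In (G ∨ H)_U each walk between the two sides passes through the cut vertex v = w: collapsing
-- the H side onto v retracts (G ∨ H)_U onto G_S, and symmetrically. Hence the components avoiding
-- v are those of G_S avoiding v together with those of H_S′ avoiding w, while the component of v
-- is the union of the components of v in G_S and of w in H_S′, which share only the cut vertex.
-- So type⁻ concatenates, type⁺ - 1 adds and (-1)^|U| multiplies. Components are computed by a
-- bounded breadth-first search, which agrees with connectivity by walks because it saturates
-- after n rounds.

open import Defs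

open import Algebra.Bundles using (CommutativeMonoid)
open import Data.Bool as Bool using (Bool; true; false; T; _∧_; _∨_; not; if_then_else_)
import Data.Bool.Properties as Bool
open import Data.Bool.Properties using (T-∨; T-∧; T-≡; ⇔→≡)
open import Data.Bool.ListAction using (or; and)
open import Data.Empty using (⊥-elim)
open import Data.Fin as Fin using (Fin)
import Data.Fin.Properties as Fin
open import Data.Integer as ℤ using (ℤ)
import Data.Integer.Properties as ℤ
open import Data.List using (List; []; _∷_; _++_; map; concatMap; filter; length; allFin; tabulate; cartesianProduct)
import Data.List.Properties as List
open import Data.List.Properties using (≡-dec)
open import Data.List.Membership.Propositional using (_∈_; find; lose)
open import Data.List.Membership.Propositional.Properties
  using (∈-allFin; ∈-map⁺; ∈-map⁻; ∈-++⁺ˡ; ∈-++⁺ʳ; ∈-++⁻; ∈-filter⁺; ∈-filter⁻; ∈-cartesianProduct⁺)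
open import Data.List.Membership.Propositional.Properties.WithK using (unique∧set⇒bag)
open import Data.List.Relation.Binary.BagAndSetEquality using (∼bag⇒↭)
open import Data.List.Relation.Binary.Permutation.Propositional
  using (_↭_; ↭-refl; ↭-prep; ↭-swap; ↭-trans; ↭-sym; ↭⇒↭ₛ; module PermutationReasoning)
import Data.List.Relation.Binary.Permutation.Propositional.Properties as ↭
open import Data.List.Relation.Binary.Permutation.Setoid.Properties using (foldr-commMonoid)
open import Data.List.Relation.Binary.Pointwise using (Pointwise-≡⇒≡)
import Data.List.Relation.Unary.All as All
import Data.List.Relation.Unary.All.Properties as All
open import Data.List.Relation.Unary.Any using (Any; here; there)
open import Data.List.Relation.Unary.Any.Properties using (any⁺; any⁻)
open import Data.List.Relation.Unary.Sorted.TotalOrder.Properties using (↗↭↗⇒≋)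
open import Data.List.Relation.Unary.Unique.Propositional using (Unique)
import Data.List.Relation.Unary.Unique.Propositional.Properties as Unique
import Data.List.Sort.InsertionSort.Properties as InsertionSort
open import Data.Nat as ℕ using (ℕ; zero; suc; _+_; _∸_; _≤_; _<_)
import Data.Nat.Properties as ℕ
open import Data.Nat.Properties using (≤-decTotalOrder)
open import Data.List.Sort.InsertionSort ≤-decTotalOrder using (sort)
open import Data.Product using (_×_; _,_; proj₁; proj₂; ∃)
open import Data.Product.Function.NonDependent.Propositional using (_×-⇔_)
open import Data.Sum as Sum using (_⊎_; inj₁; inj₂)
open import Function using (_∘_; id; _$_)
open import Function.Bundles using (_⇔_; mk⇔; Equivalence)
import Function.Properties.Equivalence as ⇔
open import Level using (0ℓ)
open import Relation.Binary.Construct.Closure.ReflexiveTransitive as Star using (Star; ε; _◅_; _◅◅_)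
open import Relation.Binary.Definitions using (tri<; tri≈; tri>)
open import Relation.Binary.PropositionalEquality
  using (_≡_; _≢_; refl; sym; trans; cong; cong₂; subst; subst₂; module ≡-Reasoning)
import Relation.Binary.Reasoning.Setoid as SetoidReasoning
open import Relation.Nullary using (¬_; yes; no)
open import Relation.Nullary.Decidable using (isYes; _×-dec_; toWitness; fromWitness)

private
  variable
    A B : Set

  T⇒≡true : ∀ {b} → T b → b ≡ true
  T⇒≡true = Equivalence.to T-≡

  ≡true⇒T : ∀ {b} → b ≡ true → T b
  ≡true⇒T = Equivalence.from T-≡

  filterᵇ-cong : ∀ {p q : A → Bool} → (∀ x → p x ≡ q x) →
                 ∀ xs → filter (λ x → p x Bool.≟ true) xs ≡ filter (λ x → q x Bool.≟ true) xs
  filterᵇ-cong p≗q = List.filter-≐ _ _ ((λ {x} → trans (sym (p≗q x))) , (λ {x} → trans (p≗q x)))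

  map-filterᵇ-cong : ∀ {p : A → Bool} {f g : A → B} → (∀ x → T (p x) → f x ≡ g x) → ∀ xs →
                     map f (filter (λ x → p x Bool.≟ true) xs) ≡ map g (filter (λ x → p x Bool.≟ true) xs)
  map-filterᵇ-cong {p = p} f≗g xs =
    List.map-cong-local (All.map (λ {x} px → f≗g x (≡true⇒T px)) (All.all-filter (λ x → p x Bool.≟ true) xs))

  ∧-not-cong : ∀ {a b} c → (¬ T c → a ≡ b) → a ∧ not c ≡ b ∧ not c
  ∧-not-cong {a} {b} true  _ = trans (Bool.∧-zeroʳ a) (sym (Bool.∧-zeroʳ b))
  ∧-not-cong         false h = cong (_∧ true) (h id)

  T-∧-not⇒¬T : ∀ {a c} → T (a ∧ not c) → ¬ T c
  T-∧-not⇒¬T {true} {false} _ ()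

  changed-bit : ∀ {a b} → (T a → T b) → b ≢ a → ¬ T a × T b
  changed-bit {true}  {true}  _   b≢a = ⊥-elim (b≢a refl)
  changed-bit {true}  {false} a⇒b _   = ⊥-elim (a⇒b _)
  changed-bit {false} {true}  _   _   = (λ ()) , _
  changed-bit {false} {false} _   b≢a = ⊥-elim (b≢a refl)

  module ⇔-Reasoning = SetoidReasoning (⇔.⇔-setoid 0ℓ)

  T-injective : ∀ {a b} → (T a ⇔ T b) → a ≡ b
  T-injective {a} {b} a⇔b = ⇔→≡ {z = true} (mk⇔ (T⇒≡true ∘ Equivalence.to a⇔b ∘ ≡true⇒T)
                                            (T⇒≡true ∘ Equivalence.from a⇔b ∘ ≡true⇒T))

infixl 7 _⊗_
_⊗_ : Term → Term → Term
(a , i , c) ⊗ (b , j , d) = a ++ b , i + j , c ℤ.* d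

*P-map : ∀ (f : A → Term) (g : B → Term) xs ys →
         map f xs *P map g ys ≡ concatMap (λ x → map (λ y → f x ⊗ g y) ys) xs
*P-map f g xs ys = trans (List.concatMap-map _ f xs) (List.concatMap-cong (λ x → sym (List.map-∘ ys)) xs)

infix 4 _≃ᵗ_
_≃ᵗ_ : Term → Term → Set
(a , i , c) ≃ᵗ (b , j , d) = a ↭ b × i ≡ j × c ≡ d

sort-↭ : ∀ {a b : List ℕ} → a ↭ b → sort a ≡ sort b
sort-↭ {a} {b} a↭b = Pointwise-≡⇒≡ (↗↭↗⇒≋ ℕ.≤-totalOrder
  (InsertionSort.sort-↗ ≤-decTotalOrder a) (InsertionSort.sort-↗ ≤-decTotalOrder b)
  (↭⇒↭ₛ (↭-trans (InsertionSort.sort-↭ ≤-decTotalOrder a)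
    (↭-trans a↭b (↭-sym (InsertionSort.sort-↭ ≤-decTotalOrder b))))))

module _ (λ′ : List ℕ) (k : ℕ) where

  termCoeff : Term → ℤ
  termCoeff (a , i , c) =
    if isYes ((≡-dec ℕ._≟_ (sort a) (sort λ′)) ×-dec (i ℕ.≟ k)) then c else ℤ.0ℤ

  termCoeff-cong : ∀ {s t} → s ≃ᵗ t → termCoeff s ≡ termCoeff t
  termCoeff-cong {a , _} {b , _} (a↭b , refl , refl) rewrite sort-↭ a↭b = refl

  coeff-↭ : ∀ {p q} → p ↭ q → coeff λ′ k p ≡ coeff λ′ k q
  coeff-↭ p↭q = foldr-commMonoid ℤ+.setoid ℤ+.isCommutativeMonoid (↭⇒↭ₛ (↭.map⁺ termCoeff p↭q))
    where module ℤ+ = CommutativeMonoid ℤ.+-0-commutativeMonoid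

  coeff-++ : ∀ p q → coeff λ′ k (p ++ q) ≡ coeff λ′ k p ℤ.+ coeff λ′ k q
  coeff-++ []      q = sym (ℤ.+-identityˡ _)
  coeff-++ (t ∷ p) q = trans (cong (λ z → termCoeff t ℤ.+ z) (coeff-++ p q)) (sym (ℤ.+-assoc (termCoeff t) _ _))

  coeff-map-cong : ∀ {f g : A → Term} → (∀ x → f x ≃ᵗ g x) →
                   ∀ xs → coeff λ′ k (map f xs) ≡ coeff λ′ k (map g xs)
  coeff-map-cong f≃g []       = refl
  coeff-map-cong f≃g (x ∷ xs) = cong₂ ℤ._+_ (termCoeff-cong (f≃g x)) (coeff-map-cong f≃g xs)

  coeff-concatMap-cong : ∀ {f g : A → Poly} → (∀ x → coeff λ′ k (f x) ≡ coeff λ′ k (g x)) →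
                         ∀ xs → coeff λ′ k (concatMap f xs) ≡ coeff λ′ k (concatMap g xs)
  coeff-concatMap-cong         f≈g []       = refl
  coeff-concatMap-cong {f = f} {g} f≈g (x ∷ xs) = begin
    coeff λ′ k (f x ++ concatMap f xs)               ≡⟨ coeff-++ (f x) _ ⟩
    coeff λ′ k (f x) ℤ.+ coeff λ′ k (concatMap f xs) ≡⟨ cong₂ ℤ._+_ (f≈g x) (coeff-concatMap-cong f≈g xs) ⟩
    coeff λ′ k (g x) ℤ.+ coeff λ′ k (concatMap g xs) ≡⟨ coeff-++ (g x) _ ⟨
    coeff λ′ k (g x ++ concatMap g xs)               ∎
    where open ≡-Reasoning

sign-+ : ∀ a b → sign (a + b) ≡ sign a ℤ.* sign b
sign-+ zero    b = sym (ℤ.*-identityˡ (sign b))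
sign-+ (suc a) b = trans (cong ℤ.-_ (sign-+ a b)) (ℤ.neg-distribˡ-* (sign a) (sign b))

subsets-map : ∀ (f : A → B) xs → subsets (map f xs) ≡ map (map f) (subsets xs)
subsets-map f []       = refl
subsets-map f (x ∷ xs) = begin
  subsets (map f xs) ++ map (f x ∷_) (subsets (map f xs))
    ≡⟨ cong (λ ss → ss ++ map (f x ∷_) ss) (subsets-map f xs) ⟩
  map (map f) (subsets xs) ++ map (f x ∷_) (map (map f) (subsets xs))
    ≡⟨ cong (map (map f) (subsets xs) ++_) (trans (sym (List.map-∘ (subsets xs))) (List.map-∘ (subsets xs))) ⟨
  map (map f) (subsets xs) ++ map (map f) (map (x ∷_) (subsets xs))
    ≡⟨ List.map-++ (map f) (subsets xs) _ ⟨
  map (map f) (subsets xs ++ map (x ∷_) (subsets xs)) ∎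
  where open ≡-Reasoning

subsets-++ : ∀ (xs ys : List A) →
             subsets (xs ++ ys) ≡ concatMap (λ S → map (S ++_) (subsets ys)) (subsets xs)
subsets-++ []       ys = sym (trans (List.++-identityʳ _) (List.map-id (subsets ys)))
subsets-++ (x ∷ xs) ys = begin
  subsets (xs ++ ys) ++ map (x ∷_) (subsets (xs ++ ys))
    ≡⟨ cong (λ ss → ss ++ map (x ∷_) ss) (subsets-++ xs ys) ⟩
  concatMap g (subsets xs) ++ map (x ∷_) (concatMap g (subsets xs))
    ≡⟨ cong (concatMap g (subsets xs) ++_) (prepend-concatMap (subsets xs)) ⟩
  concatMap g (subsets xs) ++ concatMap g (map (x ∷_) (subsets xs))
    ≡⟨ List.concatMap-++ g (subsets xs) _ ⟨
  concatMap g (subsets xs ++ map (x ∷_) (subsets xs)) ∎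
  where
  open ≡-Reasoning
  g : List _ → List (List _)
  g S = map (S ++_) (subsets ys)
  prepend-concatMap : ∀ Ss → map (x ∷_) (concatMap g Ss) ≡ concatMap g (map (x ∷_) Ss)
  prepend-concatMap Ss = begin
    map (x ∷_) (concatMap g Ss)     ≡⟨ List.map-concatMap (x ∷_) g Ss ⟩
    concatMap (map (x ∷_) ∘ g) Ss   ≡⟨ List.concatMap-cong (λ S → List.map-∘ (subsets ys)) Ss ⟨
    concatMap (g ∘ (x ∷_)) Ss       ≡⟨ List.concatMap-map g (x ∷_) Ss ⟨
    concatMap g (map (x ∷_) Ss)     ∎

map-subsets-++-map : ∀ {C D : Set} (F : List C → D) (f : A → C) (g : B → C) xs ys →
  map F (subsets (map f xs ++ map g ys)) ≡
  concatMap (λ S → map (λ S′ → F (map f S ++ map g S′)) (subsets ys)) (subsets xs)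
map-subsets-++-map F f g xs ys = begin
  map F (subsets (map f xs ++ map g ys))
    ≡⟨ cong (map F) (subsets-++ (map f xs) (map g ys)) ⟩
  map F (concatMap (λ S → map (S ++_) (subsets (map g ys))) (subsets (map f xs)))
    ≡⟨ cong₂ (λ Ss Ss′ → map F (concatMap (λ S → map (S ++_) Ss′) Ss)) (subsets-map f xs) (subsets-map g ys) ⟩
  map F (concatMap (λ S → map (S ++_) (map (map g) (subsets ys))) (map (map f) (subsets xs)))
    ≡⟨ List.map-concatMap F _ (map (map f) (subsets xs)) ⟩
  concatMap (λ S → map F (map (S ++_) (map (map g) (subsets ys)))) (map (map f) (subsets xs))
    ≡⟨ List.concatMap-map _ (map f) (subsets xs) ⟩
  concatMap (λ S → map F (map (map f S ++_) (map (map g) (subsets ys)))) (subsets xs)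
    ≡⟨ List.concatMap-cong (λ S → trans (sym (List.map-∘ _)) (sym (List.map-∘ (subsets ys)))) (subsets xs) ⟩
  concatMap (λ S → map (λ S′ → F (map f S ++ map g S′)) (subsets ys)) (subsets xs) ∎
  where open ≡-Reasoning

map-subsets-∷ : ∀ (F : List A → B) x xs →
                map F (subsets (x ∷ xs)) ≡ map F (subsets xs) ++ map (F ∘ (x ∷_)) (subsets xs)
map-subsets-∷ F x xs =
  trans (List.map-++ F (subsets xs) _) (cong (map F (subsets xs) ++_) (sym (List.map-∘ (subsets xs))))

++-interchange-↭ : ∀ (a b c d : List A) → (a ++ b) ++ (c ++ d) ↭ (a ++ c) ++ (b ++ d)
++-interchange-↭ a b c d = begin
  (a ++ b) ++ (c ++ d)  ≡⟨ List.++-assoc a b (c ++ d) ⟩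
  a ++ (b ++ (c ++ d))  ↭⟨ ↭.++⁺ˡ a (↭.shifts b c) ⟩
  a ++ (c ++ (b ++ d))  ≡⟨ List.++-assoc a c (b ++ d) ⟨
  (a ++ c) ++ (b ++ d)  ∎
  where open PermutationReasoning

map-subsets-↭ : ∀ (F : List A → B) → (∀ {S S′} → S ↭ S′ → F S ≡ F S′) →
                ∀ {xs ys} → xs ↭ ys → map F (subsets xs) ↭ map F (subsets ys)
map-subsets-↭ F F-↭ _↭_.refl = ↭-refl
map-subsets-↭ F F-↭ (_↭_.prep {xs} {ys} x p) = begin
  map F (subsets (x ∷ xs))                         ≡⟨ map-subsets-∷ F x xs ⟩
  map F (subsets xs) ++ map Fx (subsets xs)
    ↭⟨ ↭.++⁺ (map-subsets-↭ F F-↭ p) (map-subsets-↭ Fx (F-↭ ∘ ↭-prep x) p) ⟩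
  map F (subsets ys) ++ map Fx (subsets ys)  ≡⟨ map-subsets-∷ F x ys ⟨
  map F (subsets (x ∷ ys))                         ∎
  where
  open PermutationReasoning
  Fx = F ∘ (x ∷_)
map-subsets-↭ F F-↭ (_↭_.swap {xs} {ys} x y p) = begin
  map F (subsets (x ∷ y ∷ xs))                  ≡⟨ map-subsets-∷∷ x y xs ⟩
  (F₀ xs ++ F⁺ y xs) ++ (F⁺ x xs ++ F⁺⁺ x y xs)
    ↭⟨ ↭.++⁺ (↭.++⁺ (recurse F F-↭) (recurse _ (F-↭ ∘ ↭-prep y)))
             (↭.++⁺ (recurse _ (F-↭ ∘ ↭-prep x)) (recurse _ (F-↭ ∘ ↭-prep x ∘ ↭-prep y))) ⟩
  (F₀ ys ++ F⁺ y ys) ++ (F⁺ x ys ++ F⁺⁺ x y ys)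
    ↭⟨ ++-interchange-↭ (F₀ ys) _ _ _ ⟩
  (F₀ ys ++ F⁺ x ys) ++ (F⁺ y ys ++ F⁺⁺ x y ys)
    ≡⟨ cong (λ z → (F₀ ys ++ F⁺ x ys) ++ (F⁺ y ys ++ z))
            (List.map-cong (λ S → F-↭ (↭-swap x y ↭-refl)) (subsets ys)) ⟩
  (F₀ ys ++ F⁺ x ys) ++ (F⁺ y ys ++ F⁺⁺ y x ys)
    ≡⟨ map-subsets-∷∷ y x ys ⟨
  map F (subsets (y ∷ x ∷ ys))                  ∎
  where
  open PermutationReasoning
  F₀ : List _ → List _
  F₀ zs = map F (subsets zs)
  F⁺ : _ → List _ → List _
  F⁺ z zs = map (F ∘ (z ∷_)) (subsets zs)
  F⁺⁺ : _ → _ → List _ → List _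
  F⁺⁺ z z′ zs = map (F ∘ (z ∷_) ∘ (z′ ∷_)) (subsets zs)
  recurse : ∀ (G : List _ → _) → (∀ {S S′} → S ↭ S′ → G S ≡ G S′) → map G (subsets xs) ↭ map G (subsets ys)
  recurse G G-↭ = map-subsets-↭ G G-↭ p
  map-subsets-∷∷ : ∀ z z′ zs → F₀ (z ∷ z′ ∷ zs) ≡ (F₀ zs ++ F⁺ z′ zs) ++ (F⁺ z zs ++ F⁺⁺ z z′ zs)
  map-subsets-∷∷ z z′ zs = trans (map-subsets-∷ F z (z′ ∷ zs))
    (cong₂ _++_ (map-subsets-∷ F z′ zs) (map-subsets-∷ (F ∘ (z ∷_)) z′ zs))
map-subsets-↭ F F-↭ (_↭_.trans p q) = ↭-trans (map-subsets-↭ F F-↭ p) (map-subsets-↭ F F-↭ q)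

filterᵇ-map : ∀ (P : B → Bool) (f : A → B) xs →
              filter (λ y → P y Bool.≟ true) (map f xs) ≡ map f (filter (λ x → P (f x) Bool.≟ true) xs)
filterᵇ-map P f []       = refl
filterᵇ-map P f (x ∷ xs) with P (f x) Bool.≟ true
... | yes _ = cong (f x ∷_) (filterᵇ-map P f xs)
... | no  _ = filterᵇ-map P f xs

unique∧set⇒↭ : ∀ {xs ys : List A} → Unique xs → Unique ys →
               (∀ {x} → x ∈ xs → x ∈ ys) → (∀ {x} → x ∈ ys → x ∈ xs) → xs ↭ ys
unique∧set⇒↭ xs! ys! xs⊆ys ys⊆xs = ∼bag⇒↭ (unique∧set⇒bag xs! ys! (mk⇔ xs⊆ys ys⊆xs))

tabulate-+ : ∀ a b (f : Fin (a + b) → A) →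
             tabulate f ≡ tabulate (f ∘ (Fin._↑ˡ b)) ++ tabulate (f ∘ (a Fin.↑ʳ_))
tabulate-+ zero    b f = refl
tabulate-+ (suc a) b f = cong (f Fin.zero ∷_) (tabulate-+ a b (f ∘ Fin.suc))

allFin-+ : ∀ a b → allFin (a + b) ≡ map (Fin._↑ˡ b) (allFin a) ++ map (a Fin.↑ʳ_) (allFin b)
allFin-+ a b = trans (tabulate-+ a b id)
  (sym (cong₂ _++_ (List.map-tabulate id (Fin._↑ˡ b)) (List.map-tabulate id (a Fin.↑ʳ_))))

data PunchView {n : ℕ} (w : Fin (suc n)) : Fin (suc n) → Set where
  base    : PunchView w w
  punched : ∀ j → PunchView w (Fin.punchIn w j)

punchView : ∀ {n} (w c : Fin (suc n)) → PunchView w c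
punchView w c with w Fin.≟ c
... | yes refl = base
... | no  w≢c  = subst (PunchView w) (Fin.punchIn-punchOut w≢c) (punched (Fin.punchOut w≢c))

punchIn-mono-< : ∀ {n} (w : Fin (suc n)) {i j} → i Fin.< j → Fin.punchIn w i Fin.< Fin.punchIn w j
punchIn-mono-< w {i} {j} i<j = ℕ.≰⇒> (ℕ.<⇒≱ i<j ∘ Fin.punchIn-cancel-≤ w j i)

punchIn-cancel-< : ∀ {n} (w : Fin (suc n)) {i j} → Fin.punchIn w i Fin.< Fin.punchIn w j → i Fin.< j
punchIn-cancel-< w {i} {j} lt = ℕ.≰⇒> (ℕ.<⇒≱ lt ∘ Fin.punchIn-mono-≤ w j i)

allFin-punchIn : ∀ {n} (w : Fin (suc n)) → allFin (suc n) ↭ w ∷ map (Fin.punchIn w) (allFin n)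
allFin-punchIn {n} w = unique∧set⇒↭ (Unique.allFin⁺ (suc n))
  (All.map⁺ (All.tabulate (λ {j} _ → Fin.punchInᵢ≢i w j ∘ sym))
     Unique.∷ Unique.map⁺ (Fin.punchIn-injective w _ _) (Unique.allFin⁺ n))
  (λ {c} _ → ∈-punchIn c (punchView w c))
  (λ {c} _ → ∈-allFin c)
  where
  ∈-punchIn : ∀ c → PunchView w c → c ∈ w ∷ map (Fin.punchIn w) (allFin n)
  ∈-punchIn _ base        = here refl
  ∈-punchIn _ (punched j) = there (∈-map⁺ (Fin.punchIn w) (∈-allFin j))

private
  countIn : (A → Bool) → List A → ℕ
  countIn P xs = length (filter (λ x → P x Bool.≟ true) xs)

module _ {P Q : A → Bool} (P⊆Q : ∀ x → T (P x) → T (Q x)) where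

  countIn-mono : ∀ xs → countIn P xs ≤ countIn Q xs
  countIn-mono []       = ℕ.z≤n
  countIn-mono (x ∷ xs) with P x Bool.≟ true | Q x Bool.≟ true
  ... | yes _  | yes _  = ℕ.s≤s (countIn-mono xs)
  ... | yes px | no ¬qx = ⊥-elim (¬qx (T⇒≡true (P⊆Q x (≡true⇒T px))))
  ... | no _   | yes _  = ℕ.m≤n⇒m≤1+n (countIn-mono xs)
  ... | no _   | no _   = countIn-mono xs

  countIn-strictMono : ∀ {y xs} → y ∈ xs → ¬ T (P y) → T (Q y) → countIn P xs < countIn Q xs
  countIn-strictMono {y} {x ∷ xs} y∈ ¬py qy with P x Bool.≟ true | Q x Bool.≟ true | y∈
  ... | yes px | no ¬qx | _             = ⊥-elim (¬qx (T⇒≡true (P⊆Q x (≡true⇒T px))))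
  ... | no _   | no ¬qx | here refl     = ⊥-elim (¬qx (T⇒≡true qy))
  ... | yes px | yes _  | here refl     = ⊥-elim (¬py (≡true⇒T px))
  ... | no _   | yes _  | here refl     = ℕ.s≤s (countIn-mono xs)
  ... | yes _  | yes _  | there y∈xs    = ℕ.s≤s (countIn-strictMono y∈xs ¬py qy)
  ... | no _   | yes _  | there y∈xs    = ℕ.m≤n⇒m≤1+n (countIn-strictMono y∈xs ¬py qy)
  ... | no _   | no _   | there y∈xs    = countIn-strictMono y∈xs ¬py qy

module _ {P : A → Bool} where

  countIn-++ : ∀ xs ys → countIn P (xs ++ ys) ≡ countIn P xs + countIn P ys
  countIn-++ xs ys = trans (cong length (List.filter-++ (λ x → P x Bool.≟ true) xs ys)) (List.length-++ (filter _ xs))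

  countIn-↭ : ∀ {xs ys} → xs ↭ ys → countIn P xs ≡ countIn P ys
  countIn-↭ xs↭ys = ↭.↭-length (↭.filter-↭ _ xs↭ys)

  countIn-none : (∀ x → ¬ T (P x)) → ∀ xs → countIn P xs ≡ 0
  countIn-none ¬P xs =
    cong length (List.filter-none (λ x → P x Bool.≟ true) {xs} (All.tabulate (λ {x} _ → ¬P x ∘ ≡true⇒T)))

countIn-map : ∀ (P : B → Bool) (f : A → B) xs → countIn P (map f xs) ≡ countIn (P ∘ f) xs
countIn-map P f xs = trans (cong length (filterᵇ-map P f xs)) (List.length-map f (filter (λ x → P (f x) Bool.≟ true) xs))

module _ {n : ℕ} where

  count-strictMono : ∀ {P Q : Fin n → Bool} → (∀ x → T (P x) → T (Q x)) →
                     ∀ y → ¬ T (P y) → T (Q y) → count P < count Q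
  count-strictMono P⊆Q y = countIn-strictMono P⊆Q (∈-allFin y)

  count-positive : ∀ {P : Fin n → Bool} y → T (P y) → 0 < count P
  count-positive {P} y py = List.filter-some (λ x → P x Bool.≟ true) (lose (∈-allFin y) (T⇒≡true py))

  count≤n : ∀ (P : Fin n → Bool) → count P ≤ n
  count≤n P = ℕ.≤-trans (List.length-filter _ (allFin n)) (ℕ.≤-reflexive (List.length-tabulate id))

  count-cong : ∀ {P Q : Fin n → Bool} → (∀ x → P x ≡ Q x) → count P ≡ count Q
  count-cong P≗Q = cong length (filterᵇ-cong P≗Q (allFin n))

  count-none : ∀ {P : Fin n → Bool} → (∀ x → ¬ T (P x)) → count P ≡ 0
  count-none ¬P = countIn-none ¬P (allFin n)

count-+ : ∀ a b (P : Fin (a + b) → Bool) → count P ≡ count (P ∘ (Fin._↑ˡ b)) + count (P ∘ (a Fin.↑ʳ_))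
count-+ a b P = begin
  countIn P (allFin (a + b))
    ≡⟨ cong (countIn P) (allFin-+ a b) ⟩
  countIn P (map (Fin._↑ˡ b) (allFin a) ++ map (a Fin.↑ʳ_) (allFin b))
    ≡⟨ countIn-++ (map (Fin._↑ˡ b) (allFin a)) _ ⟩
  countIn P (map (Fin._↑ˡ b) (allFin a)) + countIn P (map (a Fin.↑ʳ_) (allFin b))
    ≡⟨ cong₂ _+_ (countIn-map P _ (allFin a)) (countIn-map P _ (allFin b)) ⟩
  count (P ∘ (Fin._↑ˡ b)) + count (P ∘ (a Fin.↑ʳ_)) ∎
  where open ≡-Reasoning

module _ {n : ℕ} (w : Fin (suc n)) (P : Fin (suc n) → Bool) where

  private
    P? = λ x → P x Bool.≟ true

  count-punchIn-∈ : T (P w) → count P ≡ suc (count (P ∘ Fin.punchIn w))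
  count-punchIn-∈ Pw = trans (countIn-↭ {P = P} (allFin-punchIn w))
    (trans (cong length (List.filter-accept P? {xs = map (Fin.punchIn w) (allFin n)} (T⇒≡true Pw)))
           (cong suc (countIn-map P _ (allFin n))))

  count-punchIn-∉ : ¬ T (P w) → count P ≡ count (P ∘ Fin.punchIn w)
  count-punchIn-∉ ¬Pw = trans (countIn-↭ {P = P} (allFin-punchIn w))
    (trans (cong length (List.filter-reject P? {xs = map (Fin.punchIn w) (allFin n)} (¬Pw ∘ ≡true⇒T)))
           (countIn-map P _ (allFin n)))

-- Connectivity in G_S

Edges : ℕ → Set
Edges n = List (Fin n × Fin n)

module _ {n : ℕ} where

  Adjacent : Edges n → Fin n → Fin n → Set
  Adjacent S x y = (x , y) ∈ S ⊎ (y , x) ∈ S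

  Connected : Edges n → Fin n → Fin n → Set
  Connected S = Star (Adjacent S)

  Connected-sym : ∀ {S x y} → Connected S x y → Connected S y x
  Connected-sym = Star.reverse Sum.swap

  module _ (S : Edges n) (u : Fin n) where

    private
      step : ℕ → Fin n → Fin n × Fin n → Bool
      step k x (p , q) = (reach S k u p ∧ eqF q x) ∨ (reach S k u q ∧ eqF p x)

      step-sound : ∀ k x e → e ∈ S → T (step k x e) → ∃ λ y → T (reach S k u y) × Adjacent S y x
      step-sound k x (p , q) pq∈S s with Equivalence.to T-∨ s
      ... | inj₁ s′ = let rp , qx = Equivalence.to (T-∧ {reach S k u p}) s′ in
                      p , rp , inj₁ (subst (λ z → (p , z) ∈ S) (toWitness qx) pq∈S)
      ... | inj₂ s′ = let rq , px = Equivalence.to (T-∧ {reach S k u q}) s′ in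
                      q , rq , inj₂ (subst (λ z → (z , q) ∈ S) (toWitness px) pq∈S)

    reach-sound : ∀ k x → T (reach S k u x) → Connected S u x
    reach-sound zero    x r with refl ← toWitness r = ε
    reach-sound (suc k) x r with Equivalence.to T-∨ r
    ... | inj₁ r′ = reach-sound k x r′
    ... | inj₂ r′ =
      let e , e∈S , s = find (any⁻ (step k x) S r′)
          y , ry , y~x = step-sound k x e e∈S s
      in reach-sound k y ry ◅◅ Star.return y~x

    reach-adjacent : ∀ k {y z} → T (reach S k u y) → Adjacent S y z → T (reach S (suc k) u z)
    reach-adjacent k {y} {z} r adj =
      Equivalence.from (T-∨ {reach S k u z}) (inj₂ (any⁺ (step k z) (witness adj)))
      where
      z≡z : T (eqF z z)
      z≡z = fromWitness refl
      witness : Adjacent S y z → Any (T ∘ step k z) S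
      witness (inj₁ yz∈S) = lose yz∈S (Equivalence.from T-∨ (inj₁ (Equivalence.from T-∧ (r , z≡z))))
      witness (inj₂ zy∈S) =
        lose zy∈S (Equivalence.from (T-∨ {reach S k u z ∧ eqF y z}) (inj₂ (Equivalence.from T-∧ (r , z≡z))))

    reach-complete : ∀ {x} → Connected S u x → ∃ λ k → T (reach S k u x)
    reach-complete = extend 0 (fromWitness refl)
      where
      extend : ∀ k {y x} → T (reach S k u y) → Connected S y x → ∃ λ k → T (reach S k u x)
      extend k r ε              = k , r
      extend k r (adj ◅ path) = extend (suc k) (reach-adjacent k r adj) path

    reach-+ : ∀ d {k x} → T (reach S k u x) → T (reach S (d + k) u x)
    reach-+ zero    r = r
    reach-+ (suc d) r = Equivalence.from T-∨ (inj₁ (reach-+ d r))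

    Stable : ℕ → Set
    Stable k = ∀ x → reach S (suc k) u x ≡ reach S k u x

    stable-suc : ∀ k → Stable k → Stable (suc k)
    stable-suc k st x = cong₂ _∨_ (st x) (cong or (List.map-cong step-cong S))
      where
      step-cong : ∀ e → step (suc k) x e ≡ step k x e
      step-cong (p , q) = cong₂ _∨_ (cong (_∧ eqF q x) (st p)) (cong (_∧ eqF p x) (st q))

    stable-+ : ∀ k → Stable k → ∀ d x → reach S (d + k) u x ≡ reach S k u x
    stable-+ k st zero    x = refl
    stable-+ k st (suc d) x = trans (stable-after d x) (stable-+ k st d x)
      where
      stable-after : ∀ d → Stable (d + k)
      stable-after zero    = st
      stable-after (suc d) = stable-suc (d + k) (stable-after d)

    stable-or-grows : ∀ k → Stable k ⊎ k < count (reach S k u)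
    stable-or-grows zero = inj₂ (count-positive u (fromWitness refl))
    stable-or-grows (suc k) with stable-or-grows k
    ... | inj₁ st = inj₁ (stable-suc k st)
    ... | inj₂ k<c with Fin.all? (λ x → reach S (suc k) u x Bool.≟ reach S k u x)
    ...   | yes st = inj₁ (stable-suc k st)
    ...   | no ¬st =
      let y , y-changed = Fin.¬∀⟶∃¬ n _ (λ x → reach S (suc k) u x Bool.≟ reach S k u x) ¬st
          ¬old , new = changed-bit reach-suc y-changed
      in inj₂ (ℕ.≤-trans (ℕ.s≤s k<c) (count-strictMono (λ _ → reach-suc) y ¬old new))
      where
      reach-suc : ∀ {x} → T (reach S k u x) → T (reach S (suc k) u x)
      reach-suc {x} = reach-+ 1 {k} {x}

    stable-at-n : Stable n
    stable-at-n with stable-or-grows n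
    ... | inj₁ st  = st
    ... | inj₂ n<c = ⊥-elim (ℕ.<-irrefl refl (ℕ.<-≤-trans n<c (count≤n _)))

    reach-saturates : ∀ k {x} → T (reach S k u x) → T (conn S u x)
    reach-saturates k {x} r with ℕ.≤-total k n
    ... | inj₁ k≤n = let d , k+d≡n = ℕ.m≤n⇒∃[o]m+o≡n k≤n in
      subst (λ j → T (reach S j u x)) (trans (ℕ.+-comm d k) k+d≡n) (reach-+ d r)
    ... | inj₂ n≤k = let d , n+d≡k = ℕ.m≤n⇒∃[o]m+o≡n n≤k in
      subst T (stable-+ n stable-at-n d x) (subst (λ j → T (reach S j u x)) (sym (trans (ℕ.+-comm d n) n+d≡k)) r)

  conn⇔Connected : ∀ S u x → T (conn S u x) ⇔ Connected S u x
  conn⇔Connected S u x = mk⇔ (reach-sound S u n x)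
    (λ path → let k , r = reach-complete S u path in reach-saturates S u k r)

conn-≡ : ∀ {n n′} {S : Edges n} {S′ : Edges n′} {u x u′ x′} →
         (Connected S u x ⇔ Connected S′ u′ x′) → conn S u x ≡ conn S′ u′ x′
conn-≡ {S = S} {S′} {u} {x} {u′} {x′} c⇔c′ =
  T-injective (⇔.trans (conn⇔Connected S u x) (⇔.trans c⇔c′ (⇔.sym (conn⇔Connected S′ u′ x′))))

module _ {n : ℕ} (S : Edges n) where

  conn-refl : ∀ x → T (conn S x x)
  conn-refl x = Equivalence.from (conn⇔Connected S x x) ε

  conn-sym : ∀ x y → conn S x y ≡ conn S y x
  conn-sym x y = conn-≡ {S = S} {S} {x} {y} (mk⇔ Connected-sym Connected-sym)

  conn-↭ : ∀ {S′} → S ↭ S′ → ∀ u x → conn S u x ≡ conn S′ u x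
  conn-↭ {S′} S↭S′ u x = conn-≡ {S = S} {S′} {u} {x} (mk⇔ (transport S↭S′) (transport (↭-sym S↭S′)))
    where
    transport : ∀ {S₁ S₂ : Edges n} → S₁ ↭ S₂ → ∀ {y z} → Connected S₁ y z → Connected S₂ y z
    transport S₁↭S₂ = Star.map (Sum.map (↭.∈-resp-↭ S₁↭S₂) (↭.∈-resp-↭ S₁↭S₂))

summand : ∀ {n} → Fin n → Edges n → Term
summand v S = typeMinus S v , typePlus S v ∸ 1 , sign (length S)

module _ {n : ℕ} {S S′ : Edges n} (conn≗ : ∀ u x → conn S u x ≡ conn S′ u x) where

  compSize-cong : ∀ u → compSize S u ≡ compSize S′ u
  compSize-cong u = cong length (filterᵇ-cong (conn≗ u) (allFin n))

  isRep-cong : ∀ u → isRep S u ≡ isRep S′ u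
  isRep-cong u = cong and (List.map-cong (λ x → cong (λ c → not (isYes (x Fin.<? u) ∧ c)) (conn≗ u x)) (allFin n))

  typeMinus-cong : ∀ v → typeMinus S v ≡ typeMinus S′ v
  typeMinus-cong v = trans
    (cong (map (compSize S)) (filterᵇ-cong (λ u → cong₂ (λ r c → r ∧ not c) (isRep-cong u) (conn≗ v u)) (allFin n)))
    (List.map-cong compSize-cong _)

summand-↭ : ∀ {n} (v : Fin n) {S S′ : Edges n} → S ↭ S′ → summand v S ≡ summand v S′
summand-↭ v {S} S↭S′ = cong₂ _,_ (typeMinus-cong conn≗ v)
  (cong₂ _,_ (cong (_∸ 1) (compSize-cong conn≗ v)) (cong sign (↭.↭-length S↭S′)))
  where
  conn≗ = conn-↭ S S↭S′

private
  before-condition : ∀ {n} (x u : Fin n) c → T (not (isYes (x Fin.<? u) ∧ c)) ⇔ (x Fin.< u → ¬ T c)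
  before-condition x u c with x Fin.<? u
  before-condition x u true  | yes x<u = mk⇔ (λ ()) (λ h → h x<u _)
  before-condition x u false | yes x<u = mk⇔ (λ _ _ ()) _
  ... | no x≮u = mk⇔ (λ _ x<u → ⊥-elim (x≮u x<u)) _

isRep⇔ : ∀ {n} (S : Edges n) u → T (isRep S u) ⇔ (∀ x → x Fin.< u → ¬ T (conn S u x))
isRep⇔ {n} S u = mk⇔
  (λ rep x → Equivalence.to (before-condition x u _)
                (All.lookup (All.all⁺ condition (allFin n) rep) (∈-allFin x)))
  (λ h → All.all⁻ condition {allFin n}
           (All.tabulate (λ {x} _ → Equivalence.from (before-condition x u _) (h x))))
  where
  condition = λ x → not (isYes (x Fin.<? u) ∧ conn S u x)

isRepAway : ∀ {n} → Edges n → Fin n → Fin n → Bool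
isRepAway S v u = isRep S u ∧ not (conn S v u)

typeMinus-punchIn : ∀ {n} (S : Edges (suc n)) (w : Fin (suc n)) →
  typeMinus S w ↭
  map (compSize S ∘ Fin.punchIn w) (filter (λ j → isRepAway S w (Fin.punchIn w j) Bool.≟ true) (allFin n))
typeMinus-punchIn {n} S w = begin
  map (compSize S) (filter away? (allFin (suc n)))
    ↭⟨ ↭.map⁺ (compSize S) (↭.filter-↭ away? (allFin-punchIn w)) ⟩
  map (compSize S) (filter away? (w ∷ map (Fin.punchIn w) (allFin n)))
    ≡⟨ cong (map (compSize S)) (List.filter-reject away? {x = w} {xs = map (Fin.punchIn w) (allFin n)}
                                  (λ away → T-∧-not⇒¬T (≡true⇒T away) (conn-refl S w))) ⟩
  map (compSize S) (filter away? (map (Fin.punchIn w) (allFin n)))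
    ≡⟨ cong (map (compSize S)) (filterᵇ-map (isRepAway S w) (Fin.punchIn w) (allFin n)) ⟩
  map (compSize S) (map (Fin.punchIn w) (filter (λ j → isRepAway S w (Fin.punchIn w j) Bool.≟ true) (allFin n)))
    ≡⟨ List.map-∘ _ ⟨
  map (compSize S ∘ Fin.punchIn w) (filter (λ j → isRepAway S w (Fin.punchIn w j) Bool.≟ true) (allFin n)) ∎
  where
  open PermutationReasoning
  away? = λ u → isRepAway S w u Bool.≟ true

-- Retractions

record Retraction {n n′ : ℕ} (S : Edges n) (S′ : Edges n′) : Set where
  field
    embed         : Fin n → Fin n′
    retract       : Fin n′ → Fin n
    retract-embed : ∀ a → retract (embed a) ≡ a
    embed-edge    : ∀ {a b} → (a , b) ∈ S → Adjacent S′ (embed a) (embed b)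
    retract-edge  : ∀ {x y} → (x , y) ∈ S′ → Connected S (retract x) (retract y)

  embed-connected : ∀ {a b} → Connected S a b → Connected S′ (embed a) (embed b)
  embed-connected = Star.gmap embed Sum.[ embed-edge , Sum.swap ∘ embed-edge ]

  retract-connected : ∀ {x y} → Connected S′ x y → Connected S (retract x) (retract y)
  retract-connected = Star.kleisliStar retract Sum.[ retract-edge , Connected-sym ∘ retract-edge ]

  retract-connected-embed : ∀ {a b} → Connected S′ (embed a) (embed b) → Connected S a b
  retract-connected-embed {a} {b} = subst₂ (Connected S) (retract-embed a) (retract-embed b) ∘ retract-connected

  conn-embed : ∀ a b → conn S′ (embed a) (embed b) ≡ conn S a b
  conn-embed a b = conn-≡ {S = S′} {S} (mk⇔ retract-connected-embed embed-connected)

orient : ∀ {n} → Fin n → Fin n → Fin n × Fin n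
orient p q = if isYes (p Fin.<? q) then (p , q) else (q , p)

orient-cases : ∀ {n} (p q : Fin n) → orient p q ≡ (p , q) ⊎ orient p q ≡ (q , p)
orient-cases p q with p Fin.<? q
... | yes _ = inj₁ refl
... | no _  = inj₂ refl

orient-adjacent : ∀ {n} {S : Edges n} p q → orient p q ∈ S → Adjacent S p q
orient-adjacent p q pq∈S with orient-cases p q
... | inj₁ eq = inj₁ (subst (_∈ _) eq pq∈S)
... | inj₂ eq = inj₂ (subst (_∈ _) eq pq∈S)

orient-sorted : ∀ {n} {p q : Fin n} → p Fin.< q → orient p q ≡ (p , q)
orient-sorted {p = p} {q} p<q with p Fin.<? q
... | yes _   = refl
... | no p≮q = ⊥-elim (p≮q p<q)

orient-flipped : ∀ {n} {p q : Fin n} → q Fin.< p → orient p q ≡ (q , p)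
orient-flipped {p = p} {q} q<p with p Fin.<? q
... | yes p<q = ⊥-elim (ℕ.<-asym p<q q<p)
... | no _    = refl

orient-diag : ∀ {n} (p : Fin n) → orient p p ≡ (p , p)
orient-diag p with p Fin.<? p
... | yes _ = refl
... | no _  = refl

orient-comm : ∀ {n} (p q : Fin n) → orient p q ≡ orient q p
orient-comm p q with Fin.<-cmp p q
... | tri< p<q _ _ = trans (orient-sorted p<q) (sym (orient-flipped p<q))
... | tri≈ _ refl _ = refl
... | tri> _ _ q<p = trans (orient-flipped q<p) (sym (orient-sorted q<p))

orient-map : ∀ {n n′} (f : Fin n → Fin n′) p q →
             orient (f (proj₁ (orient p q))) (f (proj₂ (orient p q))) ≡ orient (f p) (f q)
orient-map f p q with orient-cases p q
... | inj₁ eq rewrite eq = refl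
... | inj₂ eq rewrite eq = orient-comm (f q) (f p)

orient-≡ : ∀ {n} {p q x y : Fin n} → (x , y) ≡ orient p q → (x ≡ p × y ≡ q) ⊎ (x ≡ q × y ≡ p)
orient-≡ {p = p} {q} xy≡ with orient-cases p q
... | inj₁ eq with refl ← trans xy≡ eq = inj₁ (refl , refl)
... | inj₂ eq with refl ← trans xy≡ eq = inj₂ (refl , refl)

module _ {n : ℕ} (Γ : SimpleGraph n) where

  private
    edge? = λ (e : Fin n × Fin n) → (isYes (proj₁ e Fin.<? proj₂ e) ∧ adj Γ (proj₁ e) (proj₂ e)) Bool.≟ true

    allPairs≡ : ∀ (xs ys : List (Fin n)) → concatMap (λ i → map (i ,_) ys) xs ≡ cartesianProduct xs ys
    allPairs≡ []       ys = refl
    allPairs≡ (x ∷ xs) ys = cong (map (x ,_) ys ++_) (allPairs≡ xs ys)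

    edges≡ : edges Γ ≡ filter edge? (cartesianProduct (allFin n) (allFin n))
    edges≡ = cong (filter edge?) (allPairs≡ (allFin n) (allFin n))

  ∈-edges⁺ : ∀ {i j} → i Fin.< j → T (adj Γ i j) → (i , j) ∈ edges Γ
  ∈-edges⁺ {i} {j} i<j ij = subst ((i , j) ∈_) (sym edges≡) $
    ∈-filter⁺ edge? (∈-cartesianProduct⁺ (∈-allFin i) (∈-allFin j))
    (T⇒≡true (Equivalence.from T-∧ (fromWitness i<j , ij)))

  ∈-edges⁻ : ∀ {i j} → (i , j) ∈ edges Γ → i Fin.< j × T (adj Γ i j)
  ∈-edges⁻ {i} {j} ij∈ =
    let ij∈pairs = subst ((i , j) ∈_) edges≡ ij∈
        i<j , ij = Equivalence.to (T-∧ {isYes (i Fin.<? j)})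
                     (≡true⇒T (proj₂ (∈-filter⁻ edge? {xs = cartesianProduct (allFin n) (allFin n)} ij∈pairs)))
    in toWitness i<j , ij

  edges-unique : Unique (edges Γ)
  edges-unique = subst Unique (sym edges≡) $
    Unique.filter⁺ edge? (Unique.cartesianProduct⁺ (Unique.allFin⁺ n) (Unique.allFin⁺ n))

  orient-∈-edges : ∀ {p q} → T (adj Γ p q) → orient p q ∈ edges Γ
  orient-∈-edges {p} {q} pq with Fin.<-cmp p q
  ... | tri< p<q _ _ = subst (_∈ edges Γ) (sym (orient-sorted p<q)) (∈-edges⁺ p<q pq)
  ... | tri≈ _ refl _ = ⊥-elim (subst T (irrefl Γ p) pq)
  ... | tri> _ _ q<p = subst (_∈ edges Γ) (sym (orient-flipped q<p)) (∈-edges⁺ q<p (subst T (symm Γ p q) pq))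

-- The wedge sum

module WedgeVertices {m k : ℕ} (v : Fin (suc m)) (w : Fin (suc k)) where

  inG : Fin (suc m) → Fin (suc m + k)
  inG a = a Fin.↑ˡ k

  inR : Fin k → Fin (suc m + k)
  inR j = suc m Fin.↑ʳ j

  inH : Fin (suc k) → Fin (suc m + k)
  inH c with w Fin.≟ c
  ... | yes _   = inG v
  ... | no  w≢c = inR (Fin.punchOut w≢c)

  retractG : Fin (suc m + k) → Fin (suc m)
  retractG x = Sum.[ id , (λ _ → v) ] (Fin.splitAt (suc m) x)

  retractH : Fin (suc m + k) → Fin (suc k)
  retractH x = Sum.[ (λ _ → w) , Fin.punchIn w ] (Fin.splitAt (suc m) x)

  data WedgeView : Fin (suc m + k) → Set where
    fromG : ∀ a → WedgeView (inG a)
    fromR : ∀ j → WedgeView (inR j)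

  wedgeView : ∀ x → WedgeView x
  wedgeView x with Fin.splitAt (suc m) x in eq
  ... | inj₁ a = subst WedgeView (Fin.splitAt⁻¹-↑ˡ eq) (fromG a)
  ... | inj₂ j = subst WedgeView (Fin.splitAt⁻¹-↑ʳ eq) (fromR j)

  inH-base : inH w ≡ inG v
  inH-base with w Fin.≟ w
  ... | yes _   = refl
  ... | no  w≢w = ⊥-elim (w≢w refl)

  inH-punched : ∀ j → inH (Fin.punchIn w j) ≡ inR j
  inH-punched j with w Fin.≟ Fin.punchIn w j
  ... | yes w≡j = ⊥-elim (Fin.punchInᵢ≢i w j (sym w≡j))
  ... | no  w≢j = cong inR (trans (Fin.punchOut-cong w refl) (Fin.punchOut-punchIn w))

  retractG-inG : ∀ a → retractG (inG a) ≡ a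
  retractG-inG a rewrite Fin.splitAt-↑ˡ (suc m) a k = refl

  retractH-inG : ∀ a → retractH (inG a) ≡ w
  retractH-inG a rewrite Fin.splitAt-↑ˡ (suc m) a k = refl

  retractG-inR : ∀ j → retractG (inR j) ≡ v
  retractG-inR j rewrite Fin.splitAt-↑ʳ (suc m) k j = refl

  retractH-inR : ∀ j → retractH (inR j) ≡ Fin.punchIn w j
  retractH-inR j rewrite Fin.splitAt-↑ʳ (suc m) k j = refl

  retractG-inH : ∀ c → retractG (inH c) ≡ v
  retractG-inH c with punchView w c
  ... | base      = trans (cong retractG inH-base) (retractG-inG v)
  ... | punched j = trans (cong retractG (inH-punched j)) (retractG-inR j)

  retractH-inH : ∀ c → retractH (inH c) ≡ c
  retractH-inH c with punchView w c
  ... | base      = trans (cong retractH inH-base) (retractH-inG v)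
  ... | punched j = trans (cong retractH (inH-punched j)) (retractH-inR j)

  inG-mono-< : ∀ {a b} → a Fin.< b → inG a Fin.< inG b
  inG-mono-< {a} {b} = subst₂ ℕ._<_ (sym (Fin.toℕ-↑ˡ a k)) (sym (Fin.toℕ-↑ˡ b k))

  inG-cancel-< : ∀ {a b} → inG a Fin.< inG b → a Fin.< b
  inG-cancel-< {a} {b} = subst₂ ℕ._<_ (Fin.toℕ-↑ˡ a k) (Fin.toℕ-↑ˡ b k)

  inR-mono-< : ∀ {i j} → i Fin.< j → inR i Fin.< inR j
  inR-mono-< {i} {j} = subst₂ ℕ._<_ (sym (Fin.toℕ-↑ʳ (suc m) i)) (sym (Fin.toℕ-↑ʳ (suc m) j)) ∘ ℕ.+-monoʳ-< (suc m)

  inR-cancel-< : ∀ {i j} → inR i Fin.< inR j → i Fin.< j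
  inR-cancel-< {i} {j} = ℕ.+-cancelˡ-< (suc m) _ _ ∘ subst₂ ℕ._<_ (Fin.toℕ-↑ʳ (suc m) i) (Fin.toℕ-↑ʳ (suc m) j)

  inG<inR : ∀ a j → inG a Fin.< inR j
  inG<inR a j = subst₂ ℕ._<_ (sym (Fin.toℕ-↑ˡ a k)) (sym (Fin.toℕ-↑ʳ (suc m) j))
    (ℕ.<-≤-trans (Fin.toℕ<n a) (ℕ.m≤m+n (suc m) (Fin.toℕ j)))

  ιG : Fin (suc m) × Fin (suc m) → Fin (suc m + k) × Fin (suc m + k)
  ιG (a , b) = inG a , inG b

  -- inH is not monotone (w goes below every inR j), so images of sorted H-edges are re-sorted.
  ιH : Fin (suc k) × Fin (suc k) → Fin (suc m + k) × Fin (suc m + k)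
  ιH (c , d) = orient (inH c) (inH d)

module WedgeSubgraph {m k : ℕ} (v : Fin (suc m)) (w : Fin (suc k))
                     (S : Edges (suc m)) (S′ : Edges (suc k)) where

  open WedgeVertices v w

  private
    pI : Fin k → Fin (suc k)
    pI = Fin.punchIn w

  U : Edges (suc m + k)
  U = map ιG S ++ map ιH S′

  retractionG : Retraction S U
  retractionG = record
    { embed         = inG
    ; retract       = retractG
    ; retract-embed = retractG-inG
    ; embed-edge    = inj₁ ∘ ∈-++⁺ˡ ∘ ∈-map⁺ ιG
    ; retract-edge  = edge
    }
    where
    collapsed : ∀ c d → Connected S (retractG (inH c)) (retractG (inH d))
    collapsed c d = subst₂ (Connected S) (sym (retractG-inH c)) (sym (retractG-inH d)) ε
    edge : ∀ {x y} → (x , y) ∈ U → Connected S (retractG x) (retractG y)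
    edge xy∈U with ∈-++⁻ (map ιG S) xy∈U
    ... | inj₁ xy∈S with (a , b) , ab∈S , refl ← ∈-map⁻ ιG xy∈S =
      subst₂ (Connected S) (sym (retractG-inG a)) (sym (retractG-inG b)) (Star.return (inj₁ ab∈S))
    ... | inj₂ xy∈S′ with (c , d) , _ , xy≡ ← ∈-map⁻ ιH xy∈S′ with orient-≡ xy≡
    ...   | inj₁ (refl , refl) = collapsed c d
    ...   | inj₂ (refl , refl) = collapsed d c

  retractionH : Retraction S′ U
  retractionH = record
    { embed         = inH
    ; retract       = retractH
    ; retract-embed = retractH-inH
    ; embed-edge    = λ {c} {d} → orient-adjacent (inH c) (inH d) ∘ ∈-++⁺ʳ (map ιG S) ∘ ∈-map⁺ ιH
    ; retract-edge  = edge
    }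
    where
    along : ∀ {c d} → Adjacent S′ c d → Connected S′ (retractH (inH c)) (retractH (inH d))
    along {c} {d} = subst₂ (Connected S′) (sym (retractH-inH c)) (sym (retractH-inH d)) ∘ Star.return
    edge : ∀ {x y} → (x , y) ∈ U → Connected S′ (retractH x) (retractH y)
    edge xy∈U with ∈-++⁻ (map ιG S) xy∈U
    ... | inj₁ xy∈S with (a , b) , _ , refl ← ∈-map⁻ ιG xy∈S =
      subst₂ (Connected S′) (sym (retractH-inG a)) (sym (retractH-inG b)) ε
    ... | inj₂ xy∈S′ with (c , d) , cd∈S′ , xy≡ ← ∈-map⁻ ιH xy∈S′ with orient-≡ xy≡
    ...   | inj₁ (refl , refl) = along (inj₁ cd∈S′)
    ...   | inj₂ (refl , refl) = along (inj₂ cd∈S′)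

  conn-inG : ∀ a b → conn U (inG a) (inG b) ≡ conn S a b
  conn-inG = Retraction.conn-embed retractionG

  conn-inR : ∀ i j → conn U (inR i) (inR j) ≡ conn S′ (pI i) (pI j)
  conn-inR i j = subst₂ (λ x y → conn U x y ≡ conn S′ (pI i) (pI j)) (inH-punched i) (inH-punched j)
    (Retraction.conn-embed retractionH (pI i) (pI j))

  Connected-inG-inH : ∀ a c → Connected U (inG a) (inH c) ⇔ (Connected S a v × Connected S′ w c)
  Connected-inG-inH a c = mk⇔
    (λ path → subst₂ (Connected S) (retractG-inG a) (retractG-inH c) (G.retract-connected path)
            , subst₂ (Connected S′) (retractH-inG a) (retractH-inH c) (H.retract-connected path))
    (λ (path₁ , path₂) →
      G.embed-connected path₁ ◅◅ subst (λ z → Connected U z (inH c)) inH-base (H.embed-connected path₂))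
    where
    module G = Retraction retractionG
    module H = Retraction retractionH

  conn-inG-inH : ∀ a c → conn U (inG a) (inH c) ≡ conn S a v ∧ conn S′ w c
  conn-inG-inH a c = T-injective (begin
    T (conn U (inG a) (inH c))          ≈⟨ conn⇔Connected U (inG a) (inH c) ⟩
    Connected U (inG a) (inH c)         ≈⟨ Connected-inG-inH a c ⟩
    (Connected S a v × Connected S′ w c) ≈⟨ conn⇔Connected S a v ×-⇔ conn⇔Connected S′ w c ⟨
    (T (conn S a v) × T (conn S′ w c))   ≈⟨ T-∧ ⟨
    T (conn S a v ∧ conn S′ w c)        ∎)
    where open ⇔-Reasoning

  conn-inG-inR : ∀ a j → conn U (inG a) (inR j) ≡ conn S a v ∧ conn S′ w (pI j)
  conn-inG-inR a j = subst (λ y → conn U (inG a) y ≡ conn S a v ∧ conn S′ w (pI j))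
                           (inH-punched j) (conn-inG-inH a (pI j))

  inG≁inR : ∀ {a} j → ¬ T (conn S v a) → ¬ T (conn U (inG a) (inR j))
  inG≁inR {a} j v≁a = v≁a ∘ subst T (conn-sym S a v) ∘ proj₁ ∘ Equivalence.to T-∧ ∘ subst T (conn-inG-inR a j)

  inR≁inG : ∀ {j} b → ¬ T (conn S′ w (pI j)) → ¬ T (conn U (inR j) (inG b))
  inR≁inG {j} b w≁j =
    w≁j ∘ proj₂ ∘ Equivalence.to (T-∧ {conn S b v}) ∘ subst T (trans (conn-sym U (inR j) (inG b)) (conn-inG-inR b j))

  conn-base-inR : ∀ j → conn U (inG v) (inR j) ≡ conn S′ w (pI j)
  conn-base-inR j = trans (conn-inG-inR v j) (cong (_∧ conn S′ w (pI j)) (T⇒≡true (conn-refl S v)))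

  compSize-inG : ∀ a → ¬ T (conn S v a) → compSize U (inG a) ≡ compSize S a
  compSize-inG a v≁a = begin
    compSize U (inG a)
      ≡⟨ count-+ (suc m) k (conn U (inG a)) ⟩
    count (conn U (inG a) ∘ inG) + count (conn U (inG a) ∘ inR)
      ≡⟨ cong₂ _+_ (count-cong (conn-inG a)) (count-none (λ j → inG≁inR j v≁a)) ⟩
    compSize S a + 0
      ≡⟨ ℕ.+-identityʳ _ ⟩
    compSize S a ∎
    where open ≡-Reasoning

  compSize-inR : ∀ j → ¬ T (conn S′ w (pI j)) → compSize U (inR j) ≡ compSize S′ (pI j)
  compSize-inR j w≁j = begin
    compSize U (inR j)
      ≡⟨ count-+ (suc m) k (conn U (inR j)) ⟩
    count (conn U (inR j) ∘ inG) + count (conn U (inR j) ∘ inR)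
      ≡⟨ cong₂ _+_ (count-none (λ b → inR≁inG b w≁j)) (count-cong (conn-inR j)) ⟩
    count (conn S′ (pI j) ∘ pI)
      ≡⟨ count-punchIn-∉ w (conn S′ (pI j)) (w≁j ∘ subst T (conn-sym S′ (pI j) w)) ⟨
    compSize S′ (pI j) ∎
    where open ≡-Reasoning

  compSize-base : compSize U (inG v) ∸ 1 ≡ (compSize S v ∸ 1) + (compSize S′ w ∸ 1)
  compSize-base = begin
    compSize U (inG v) ∸ 1
      ≡⟨ cong (_∸ 1) (count-+ (suc m) k (conn U (inG v))) ⟩
    (count (conn U (inG v) ∘ inG) + count (conn U (inG v) ∘ inR)) ∸ 1
      ≡⟨ cong (λ n → (n + count (conn U (inG v) ∘ inR)) ∸ 1) (count-cong (conn-inG v)) ⟩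
    (compSize S v + count (conn U (inG v) ∘ inR)) ∸ 1
      ≡⟨ ℕ.+-∸-comm _ (count-positive {P = conn S v} v (conn-refl S v)) ⟩
    (compSize S v ∸ 1) + count (conn U (inG v) ∘ inR)
      ≡⟨ cong ((compSize S v ∸ 1) +_) (count-cong conn-base-inR) ⟩
    (compSize S v ∸ 1) + count (conn S′ w ∘ pI)
      ≡⟨ cong (λ n → (compSize S v ∸ 1) + (n ∸ 1)) (count-punchIn-∈ w (conn S′ w) (conn-refl S′ w)) ⟨
    (compSize S v ∸ 1) + (compSize S′ w ∸ 1) ∎
    where open ≡-Reasoning

  isRep-inG : ∀ a → ¬ T (conn S v a) → isRep U (inG a) ≡ isRep S a
  isRep-inG a v≁a = T-injective (⇔.trans (isRep⇔ U (inG a)) (⇔.trans (mk⇔ to from) (⇔.sym (isRep⇔ S a))))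
    where
    to : (∀ x → x Fin.< inG a → ¬ T (conn U (inG a) x)) → ∀ b → b Fin.< a → ¬ T (conn S a b)
    to rep b b<a = rep (inG b) (inG-mono-< b<a) ∘ subst T (sym (conn-inG a b))
    from : (∀ b → b Fin.< a → ¬ T (conn S a b)) → ∀ x → x Fin.< inG a → ¬ T (conn U (inG a) x)
    from rep x x<a with wedgeView x
    ... | fromG b = rep b (inG-cancel-< x<a) ∘ subst T (conn-inG a b)
    ... | fromR j = inG≁inR j v≁a

  isRep-inR : ∀ j → ¬ T (conn S′ w (pI j)) → isRep U (inR j) ≡ isRep S′ (pI j)
  isRep-inR j w≁j = T-injective (⇔.trans (isRep⇔ U (inR j)) (⇔.trans (mk⇔ to from) (⇔.sym (isRep⇔ S′ (pI j)))))
    where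
    to : (∀ x → x Fin.< inR j → ¬ T (conn U (inR j) x)) → ∀ c → c Fin.< pI j → ¬ T (conn S′ (pI j) c)
    to rep c c<j with punchView w c
    ... | base      = w≁j ∘ subst T (conn-sym S′ (pI j) w)
    ... | punched i = rep (inR i) (inR-mono-< (punchIn-cancel-< w c<j)) ∘ subst T (sym (conn-inR j i))
    from : (∀ c → c Fin.< pI j → ¬ T (conn S′ (pI j) c)) → ∀ x → x Fin.< inR j → ¬ T (conn U (inR j) x)
    from rep x x<j with wedgeView x
    ... | fromG b = inR≁inG b w≁j
    ... | fromR i = rep (pI i) (punchIn-mono-< w (inR-cancel-< x<j)) ∘ subst T (conn-inR j i)

  isRepAway-inG : ∀ a → isRepAway U (inG v) (inG a) ≡ isRepAway S v a
  isRepAway-inG a = trans (cong (λ c → isRep U (inG a) ∧ not c) (conn-inG v a)) (∧-not-cong (conn S v a) (isRep-inG a))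

  isRepAway-inR : ∀ j → isRepAway U (inG v) (inR j) ≡ isRepAway S′ w (pI j)
  isRepAway-inR j = trans (cong (λ c → isRep U (inR j) ∧ not c) (conn-base-inR j))
                          (∧-not-cong (conn S′ w (pI j)) (isRep-inR j))

  filter-isRepAway-wedge :
    filter (λ x → isRepAway U (inG v) x Bool.≟ true) (allFin (suc m + k)) ≡
    map inG (filter (λ a → isRepAway S v a Bool.≟ true) (allFin (suc m))) ++
    map inR (filter (λ j → isRepAway S′ w (pI j) Bool.≟ true) (allFin k))
  filter-isRepAway-wedge = begin
    filter away?ᵁ (allFin (suc m + k))
      ≡⟨ cong (filter away?ᵁ) (allFin-+ (suc m) k) ⟩
    filter away?ᵁ (map inG (allFin (suc m)) ++ map inR (allFin k))
      ≡⟨ List.filter-++ away?ᵁ (map inG (allFin (suc m))) _ ⟩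
    filter away?ᵁ (map inG (allFin (suc m))) ++ filter away?ᵁ (map inR (allFin k))
      ≡⟨ cong₂ _++_ (filterᵇ-map (isRepAway U (inG v)) inG (allFin (suc m)))
                    (filterᵇ-map (isRepAway U (inG v)) inR (allFin k)) ⟩
    map inG (filter (λ a → isRepAway U (inG v) (inG a) Bool.≟ true) (allFin (suc m))) ++
    map inR (filter (λ j → isRepAway U (inG v) (inR j) Bool.≟ true) (allFin k))
      ≡⟨ cong₂ (λ as js → map inG as ++ map inR js)
               (filterᵇ-cong isRepAway-inG (allFin (suc m))) (filterᵇ-cong isRepAway-inR (allFin k)) ⟩
    map inG (filter (λ a → isRepAway S v a Bool.≟ true) (allFin (suc m))) ++
    map inR (filter (λ j → isRepAway S′ w (pI j) Bool.≟ true) (allFin k)) ∎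
    where
    open ≡-Reasoning
    away?ᵁ = λ x → isRepAway U (inG v) x Bool.≟ true

  typeMinus-wedge : typeMinus U (inG v) ↭ typeMinus S v ++ typeMinus S′ w
  typeMinus-wedge = begin
    map (compSize U) (filter (λ x → isRepAway U (inG v) x Bool.≟ true) (allFin (suc m + k)))
      ≡⟨ cong (map (compSize U)) filter-isRepAway-wedge ⟩
    map (compSize U) (map inG repsG ++ map inR repsH)
      ≡⟨ List.map-++ (compSize U) (map inG repsG) _ ⟩
    map (compSize U) (map inG repsG) ++ map (compSize U) (map inR repsH)
      ≡⟨ cong₂ _++_ (List.map-∘ repsG) (List.map-∘ repsH) ⟨
    map (compSize U ∘ inG) repsG ++ map (compSize U ∘ inR) repsH
      ≡⟨ cong₂ _++_ (map-filterᵇ-cong (λ a → compSize-inG a ∘ T-∧-not⇒¬T {isRep S a}) (allFin (suc m)))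
                    (map-filterᵇ-cong (λ j → compSize-inR j ∘ T-∧-not⇒¬T {isRep S′ (pI j)}) (allFin k)) ⟩
    typeMinus S v ++ map (compSize S′ ∘ pI) repsH
      ↭⟨ ↭.++⁺ˡ (typeMinus S v) (typeMinus-punchIn S′ w) ⟨
    typeMinus S v ++ typeMinus S′ w ∎
    where
    open PermutationReasoning
    repsG = filter (λ a → isRepAway S v a Bool.≟ true) (allFin (suc m))
    repsH = filter (λ j → isRepAway S′ w (pI j) Bool.≟ true) (allFin k)

  summand-wedge : summand (inG v) U ≃ᵗ summand v S ⊗ summand w S′
  summand-wedge = typeMinus-wedge , compSize-base , (begin
    sign (length (map ιG S ++ map ιH S′))          ≡⟨ cong sign (List.length-++ (map ιG S)) ⟩
    sign (length (map ιG S) + length (map ιH S′))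
      ≡⟨ cong₂ (λ a b → sign (a + b)) (List.length-map ιG S) (List.length-map ιH S′) ⟩
    sign (length S + length S′)                    ≡⟨ sign-+ (length S) (length S′) ⟩
    sign (length S) ℤ.* sign (length S′)           ∎)
    where open ≡-Reasoning

module WedgeEdges {m k : ℕ} (G : SimpleGraph (suc m)) (v : Fin (suc m))
                  (H : SimpleGraph (suc k)) (w : Fin (suc k)) where

  open WedgeVertices v w

  private
    W = wedge G v H w
    pI = Fin.punchIn w

  adj-inG-inG : ∀ a b → adj W (inG a) (inG b) ≡ adj G a b
  adj-inG-inG a b rewrite Fin.splitAt-↑ˡ (suc m) a k | Fin.splitAt-↑ˡ (suc m) b k = refl

  adj-inG-inR : ∀ a j → adj W (inG a) (inR j) ≡ (if eqF a v then adj H w (pI j) else false)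
  adj-inG-inR a j rewrite Fin.splitAt-↑ˡ (suc m) a k | Fin.splitAt-↑ʳ (suc m) k j = refl

  adj-inR-inR : ∀ i j → adj W (inR i) (inR j) ≡ adj H (pI i) (pI j)
  adj-inR-inR i j rewrite Fin.splitAt-↑ʳ (suc m) k i | Fin.splitAt-↑ʳ (suc m) k j = refl

  adj-base-inR : ∀ j → adj W (inG v) (inR j) ≡ adj H w (pI j)
  adj-base-inR j = trans (adj-inG-inR v j)
    (cong (if_then adj H w (pI j) else false) (T⇒≡true (fromWitness {a? = v Fin.≟ v} refl)))

  adj-inH-inH : ∀ c d → adj W (inH c) (inH d) ≡ adj H c d
  adj-inH-inH c d with punchView w c | punchView w d
  ... | base      | base      = trans (cong₂ (adj W) inH-base inH-base)
                                  (trans (adj-inG-inG v v) (trans (irrefl G v) (sym (irrefl H w))))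
  ... | base      | punched j = trans (cong₂ (adj W) inH-base (inH-punched j)) (adj-base-inR j)
  ... | punched i | base      = trans (cong₂ (adj W) (inH-punched i) inH-base)
                                  (trans (symm W (inR i) (inG v)) (trans (adj-base-inR i) (symm H w (pI i))))
  ... | punched i | punched j = trans (cong₂ (adj W) (inH-punched i) (inH-punched j)) (adj-inR-inR i j)

  private
    L : Edges (suc m + k)
    L = map ιG (edges G) ++ map ιH (edges H)

    T-if : ∀ {b x} → T (if b then x else false) → T b × T x
    T-if {true} x = _ , x

  inH-edge : ∀ {c d} → T (adj H c d) → inH c Fin.< inH d → (inH c , inH d) ∈ map ιH (edges H)
  inH-edge {c} {d} cd c<d = subst (_∈ map ιH (edges H)) (trans (orient-map inH c d) (orient-sorted c<d))
                                  (∈-map⁺ ιH (orient-∈-edges H cd))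

  edges-wedge⊆ : ∀ {e} → e ∈ edges W → e ∈ L
  edges-wedge⊆ {x , y} xy∈ = edge (wedgeView x) (wedgeView y) (∈-edges⁻ W xy∈)
    where
    edge : ∀ {x y} → WedgeView x → WedgeView y → x Fin.< y × T (adj W x y) → (x , y) ∈ L
    edge (fromG a) (fromG b) (x<y , xy) =
      ∈-++⁺ˡ (∈-map⁺ ιG (∈-edges⁺ G (inG-cancel-< x<y) (subst T (adj-inG-inG a b) xy)))
    edge (fromG a) (fromR j) (x<y , xy) with a≡v , wj ← T-if (subst T (adj-inG-inR a j) xy) with toWitness {a? = a Fin.≟ v} a≡v
    ... | refl = ∈-++⁺ʳ (map ιG (edges G)) (subst₂ (λ p q → (p , q) ∈ map ιH (edges H)) inH-base (inH-punched j)
                   (inH-edge wj (subst₂ Fin._<_ (sym inH-base) (sym (inH-punched j)) x<y)))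
    edge (fromR j) (fromG b) (x<y , _)  = ⊥-elim (ℕ.<-asym x<y (inG<inR b j))
    edge (fromR i) (fromR j) (x<y , xy) =
      ∈-++⁺ʳ (map ιG (edges G)) (subst₂ (λ p q → (p , q) ∈ map ιH (edges H)) (inH-punched i) (inH-punched j)
        (inH-edge (subst T (adj-inR-inR i j) xy) (subst₂ Fin._<_ (sym (inH-punched i)) (sym (inH-punched j)) x<y)))

  L⊆edges-wedge : ∀ {e} → e ∈ L → e ∈ edges W
  L⊆edges-wedge e∈ with ∈-++⁻ (map ιG (edges G)) e∈
  ... | inj₁ e∈G with (a , b) , ab∈ , refl ← ∈-map⁻ ιG e∈G =
    let a<b , ab = ∈-edges⁻ G ab∈ in ∈-edges⁺ W (inG-mono-< a<b) (subst T (sym (adj-inG-inG a b)) ab)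
  ... | inj₂ e∈H with (c , d) , cd∈ , refl ← ∈-map⁻ ιH e∈H =
    orient-∈-edges W (subst T (sym (adj-inH-inH c d)) (proj₂ (∈-edges⁻ H cd∈)))

  private
    unwedgeH : Fin (suc m + k) × Fin (suc m + k) → Fin (suc k) × Fin (suc k)
    unwedgeH (x , y) = orient (retractH x) (retractH y)

    unwedgeH-ιH : ∀ {e} → e ∈ edges H → unwedgeH (ιH e) ≡ e
    unwedgeH-ιH {c , d} cd∈ = trans (orient-map retractH (inH c) (inH d))
      (trans (cong₂ orient (retractH-inH c) (retractH-inH d)) (orient-sorted (proj₁ (∈-edges⁻ H cd∈))))

    unwedgeH-ιG : ∀ e → unwedgeH (ιG e) ≡ (w , w)
    unwedgeH-ιG (a , b) = trans (cong₂ orient (retractH-inG a) (retractH-inG b)) (orient-diag w)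

  -- Retracting onto H recovers each H-edge and sends every G-edge to the loop (w , w).
  L-unique : Unique L
  L-unique = Unique.++⁺ (Unique.map⁺ ιG-injective (edges-unique G)) ιH-unique disjoint
    where
    ιG-injective : ∀ {e e′} → ιG e ≡ ιG e′ → e ≡ e′
    ιG-injective {a , b} {a′ , b′} eq =
      cong₂ _,_ (Fin.↑ˡ-injective k a a′ (cong proj₁ eq)) (Fin.↑ˡ-injective k b b′ (cong proj₂ eq))
    ιH-unique : Unique (map ιH (edges H))
    ιH-unique = Unique.map⁻ {f = unwedgeH} (subst Unique (sym retracts) (edges-unique H))
      where
      retracts : map unwedgeH (map ιH (edges H)) ≡ edges H
      retracts = trans (sym (List.map-∘ (edges H)))
        (trans (List.map-cong-local (All.tabulate unwedgeH-ιH)) (List.map-id (edges H)))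
    disjoint : ∀ {e} → ¬ (e ∈ map ιG (edges G) × e ∈ map ιH (edges H))
    disjoint (e∈G , e∈H) with g , _ , refl ← ∈-map⁻ ιG e∈G with (c , d) , cd∈ , eq ← ∈-map⁻ ιH e∈H =
      let cd≡ww = trans (sym (unwedgeH-ιH cd∈)) (trans (cong unwedgeH (sym eq)) (unwedgeH-ιG g))
      in ℕ.<-irrefl (cong Fin.toℕ (trans (cong proj₁ cd≡ww) (sym (cong proj₂ cd≡ww)))) (proj₁ (∈-edges⁻ H cd∈))

  edges-wedge-↭ : edges W ↭ map ιG (edges G) ++ map ιH (edges H)
  edges-wedge-↭ = unique∧set⇒↭ (edges-unique W) L-unique edges-wedge⊆ L⊆edges-wedge

proposition3p4 : ∀ {m k : ℕ} (G : SimpleGraph (suc m)) (v : Fin (suc m))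
                 (H : SimpleGraph (suc k)) (w : Fin (suc k)) →
                 X (wedge G v H w) (wedgePt G v H w) ≈P (X G v *P X H w)
proposition3p4 {m} {k} G v H w λ′ t = begin
  coeff λ′ t (map (summand (inG v)) (subsets (edges (wedge G v H w))))
    ≡⟨ coeff-↭ λ′ t (map-subsets-↭ (summand (inG v)) (summand-↭ (inG v)) edges-wedge-↭) ⟩
  coeff λ′ t (map (summand (inG v)) (subsets (map ιG (edges G) ++ map ιH (edges H))))
    ≡⟨ cong (coeff λ′ t) (map-subsets-++-map (summand (inG v)) ιG ιH (edges G) (edges H)) ⟩
  coeff λ′ t (concatMap (λ S → map (λ S′ → summand (inG v) (map ιG S ++ map ιH S′)) subsetsH) subsetsG)
    ≡⟨ coeff-concatMap-cong λ′ t (λ S → coeff-map-cong λ′ t (summand-wedge v w S) subsetsH) subsetsG ⟩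
  coeff λ′ t (concatMap (λ S → map (λ S′ → summand v S ⊗ summand w S′) subsetsH) subsetsG)
    ≡⟨ cong (coeff λ′ t) (*P-map (summand v) (summand w) subsetsG subsetsH) ⟨
  coeff λ′ t (X G v *P X H w) ∎
  where
  open ≡-Reasoning
  open WedgeVertices v w
  open WedgeEdges G v H w
  open WedgeSubgraph using (summand-wedge)
  subsetsG = subsets (edges G)
  subsetsH = subsets (edges H)
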